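{- Let $H \neq \emptyset$ be a hypergraph, let $e \in H$, and let $s \subseteq e$ with $s \neq \emptyset$. Define $H_1 = H - (e \setminus s)$, $H_2 = H_1 \setminus N_{H_1}(s)$ (the family $H_1$ with the hyperedges of $N_{H_1}(s)$ removed), and $n_1 = |V(H_1) \setminus (V(H_2) \cup s)|$. Then $$|hit_H(e,s)| = 2^{n_1} \cdot |hit_{H_2}|.$$
   Context: A hypergraph $H$ is a finite family of subsets (hyperedges) of a finite set, and its vertex set is $V(H) = \bigcup_{e \in H} e$. For a set $p$, $H - p = \{f \setminus p : f \in H\}$ is the hypergraph obtained by deleting the vertices of $p$ from every hyperedge. For $s \subseteq V(H)$, $N_H(s) = \{f \in H : f \cap s \neq \emptyset\}$. A hitting set of $H$ is a set $t \subseteq V(H)$ with $N_H(t) = H$; $hit_H$ denotes the set of all hitting sets of $H$, with the convention $|hit_H| = 1$ when $H = \emptyset$. For $e \in H$ and non-empty $s \subseteq e$, $hit_H(e,s) = \{t \in hit_H : t \cap e = s\}$. -}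

module Defs where

open import Data.Nat using (ℕ; zero; suc)
open import Data.Bool using (true; false)
import Data.Bool.Properties as BoolP
open import Data.List using (List; []; _∷_; map; filter; length; _++_; foldr)
open import Data.List.Relation.Unary.All using (All; all?)
open import Data.Vec using (_∷_; [])
open import Data.Vec.Properties using (≡-dec)
open import Data.Fin.Subset using (Subset; _∩_; _∪_; _─_; _⊆_; ⋃; Nonempty)
open import Data.Fin.Subset.Properties using (_⊆?_; nonempty?)
open import Data.Product using (_×_)
open import Relation.Nullary using (Dec; ¬_)
open import Relation.Nullary.Decidable using (_×-dec_; ¬?)
open import Relation.Binary.PropositionalEquality using (_≡_)

Hypergraph : ℕ → Set
Hypergraph n = List (Subset n)

V : ∀ {n} → Hypergraph n → Subset n
V = ⋃

_−ᴴ_ : ∀ {n} → Hypergraph n → Subset n → Hypergraph n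
H −ᴴ p = map (λ f → f ─ p) H

Meets : ∀ {n} → Subset n → Subset n → Set
Meets s f = Nonempty (f ∩ s)

meets? : ∀ {n} (s f : Subset n) → Dec (Meets s f)
meets? s f = nonempty? (f ∩ s)

N : ∀ {n} → Hypergraph n → Subset n → Hypergraph n
N H s = filter (meets? s) H

_∖N_ : ∀ {n} → Hypergraph n → Subset n → Hypergraph n
H ∖N s = filter (λ f → ¬? (meets? s f)) H

IsHit : ∀ {n} → Hypergraph n → Subset n → Set
IsHit H t = (t ⊆ V H) × All (Meets t) H

isHit? : ∀ {n} (H : Hypergraph n) (t : Subset n) → Dec (IsHit H t)
isHit? H t = (t ⊆? V H) ×-dec all? (meets? t) H

allSubsets : ∀ n → List (Subset n)
allSubsets zero = [] ∷ []
allSubsets (suc n) = map (false ∷_) (allSubsets n) ++ map (true ∷_) (allSubsets n)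

_≟ˢ_ : ∀ {n} (p q : Subset n) → Dec (p ≡ q)
_≟ˢ_ = ≡-dec BoolP._≟_

-- |hit_H|  (equals 1 when H = [] since only ∅ ⊆ V(∅))
numHit : ∀ {n} → Hypergraph n → ℕ
numHit {n} H = length (filter (isHit? H) (allSubsets n))

numHitES : ∀ {n} → Hypergraph n → Subset n → Subset n → ℕ
numHitES {n} H e s =
  length (filter (λ t → isHit? H t ×-dec ((t ∩ e) ≟ˢ s)) (allSubsets n))

-- A set t with t ∩ e = s contains s and avoids e ∖ s, so it lies inside V(H₁). It hits every
-- hyperedge f whose trace f ∖ (e ∖ s) meets s, and any other f exactly when t ∩ V(H₂) hits that
-- trace, which is a hyperedge of H₂. Since V(H₁) is the disjoint union of F = V(H₁) ∖ (V(H₂) ∪ s),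
-- V(H₂) and s, the map t ↦ (t ∩ F, t ∩ V(H₂)) is then a bijection from hit_H(e,s) onto
-- 2^F × hit_{H₂}; it is counted coordinate by coordinate over the enumeration of subsets.
module Submission where

open import Defs
open import Data.Bool using (true; false; _∨_; _∧_)
open import Data.Empty using (⊥-elim)
open import Data.Fin.Subset using (Subset; _⊆_; _∪_; _∩_; _─_; ∣_∣; Nonempty; ⊥; ⋃)
  renaming (_∈_ to _∈ˢ_; _∉_ to _∉ˢ_)
open import Data.Fin.Subset.Properties
open import Data.List using (List; []; _∷_; map; filter; length; _++_)
open import Data.List.Properties using (length-++; filter-++; filter-≐; filter-none)
open import Data.List.Membership.Propositional using (_∈_)
open import Data.List.Membership.Propositional.Properties using (∈-map⁺; ∈-map⁻; ∈-filter⁺; ∈-filter⁻)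
open import Data.List.Relation.Unary.All as All using (All)
open import Data.List.Relation.Unary.Any as Any using ()
open import Data.Nat using (ℕ; suc; _+_; _*_; _^_)
open import Data.Nat.Properties using (+-identityʳ; *-assoc; *-distribˡ-+)
open import Data.Product using (_×_; _,_; proj₁; proj₂; ∃-syntax)
open import Data.Product.Function.NonDependent.Propositional using (_×-⇔_)
open import Data.Sum using (inj₁; inj₂; [_,_])
open import Data.Vec using (_∷_; [])
open import Data.Vec.Base using (here; there)
open import Data.Vec.Properties using (∷-injectiveˡ; ∷-injectiveʳ)
open import Function using (_∘_; case_of_)
open import Function.Bundles using (_⇔_; mk⇔; module Equivalence)
open import Function.Construct.Composition using (_⇔-∘_)
open import Function.Construct.Identity using (⇔-id)
open import Relation.Nullary using (yes; no; ¬_)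
open import Relation.Nullary.Decidable using (_×-dec_; ¬?)
open import Relation.Unary using (Decidable)
open import Relation.Binary.PropositionalEquality
  using (_≡_; _≢_; refl; sym; trans; cong; cong₂; subst; module ≡-Reasoning)
open ≡-Reasoning

x∈p─q⇒x∉q : ∀ {n} (p q : Subset n) {x} → x ∈ˢ p ─ q → x ∉ˢ q
x∈p─q⇒x∉q (_ ∷ p) (true  ∷ q) (there x∈p─q) (there x∈q) = x∈p─q⇒x∉q p q x∈p─q x∈q
x∈p─q⇒x∉q (_ ∷ p) (false ∷ q) (there x∈p─q) (there x∈q) = x∈p─q⇒x∉q p q x∈p─q x∈q

inside⊈outside : ∀ {n} {p q : Subset n} → ¬ (true ∷ p ⊆ false ∷ q)
inside⊈outside p⊆q with p⊆q here
... | ()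

⊥─p≡⊥ : ∀ {n} (p : Subset n) → ⊥ ─ p ≡ ⊥
⊥─p≡⊥ []          = refl
⊥─p≡⊥ (true  ∷ p) = cong (false ∷_) (⊥─p≡⊥ p)
⊥─p≡⊥ (false ∷ p) = cong (false ∷_) (⊥─p≡⊥ p)

p─r∪q─r≡p∪q─r : ∀ {n} (p q r : Subset n) → (p ─ r) ∪ (q ─ r) ≡ (p ∪ q) ─ r
p─r∪q─r≡p∪q─r []      []      []          = refl
p─r∪q─r≡p∪q─r (x ∷ p) (y ∷ q) (true  ∷ r) = cong (false ∷_) (p─r∪q─r≡p∪q─r p q r)
p─r∪q─r≡p∪q─r (x ∷ p) (y ∷ q) (false ∷ r) = cong ((x ∨ y) ∷_) (p─r∪q─r≡p∪q─r p q r)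

p─q∩r≡⊥ : ∀ {n} (p : Subset n) {q r : Subset n} → r ⊆ q → (p ─ q) ∩ r ≡ ⊥
p─q∩r≡⊥ p {q} {r} r⊆q = Empty-unique λ (x , x∈) →
  x∈p─q⇒x∉q p q (p∩q⊆p (p ─ q) r x∈) (r⊆q (p∩q⊆q (p ─ q) r x∈))

x∈⋃⁺ : ∀ {n} {H : List (Subset n)} {f x} → f ∈ H → x ∈ˢ f → x ∈ˢ ⋃ H
x∈⋃⁺             (Any.here refl)  x∈f = p⊆p∪q _ x∈f
x∈⋃⁺ {H = g ∷ H} (Any.there f∈H) x∈f = q⊆p∪q g (⋃ H) (x∈⋃⁺ f∈H x∈f)

x∈⋃⁻ : ∀ {n} (H : List (Subset n)) {x} → x ∈ˢ ⋃ H → ∃[ f ] f ∈ H × x ∈ˢ f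
x∈⋃⁻ []      x∈⊥ = ⊥-elim (∉⊥ x∈⊥)
x∈⋃⁻ (g ∷ H) x∈  with x∈p∪q⁻ g (⋃ H) x∈
... | inj₁ x∈g   = g , Any.here refl , x∈g
... | inj₂ x∈⋃H  with x∈⋃⁻ H x∈⋃H
...   | f , f∈H , x∈f = f , Any.there f∈H , x∈f

⋃-map-─ : ∀ {n} (H : List (Subset n)) (p : Subset n) → ⋃ (map (_─ p) H) ≡ ⋃ H ─ p
⋃-map-─ []      p = sym (⊥─p≡⊥ p)
⋃-map-─ (f ∷ H) p = trans (cong ((f ─ p) ∪_) (⋃-map-─ H p)) (p─r∪q─r≡p∪q─r f (⋃ H) p)

s⊆t⊆U⇔split : ∀ {n} {U B s t : Subset n} → B ∪ s ⊆ U →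
               (s ⊆ t × t ⊆ U) ⇔ (t ─ (U ─ (B ∪ s)) ≡ s ∪ (t ∩ B))
s⊆t⊆U⇔split {n} {U} {B} {s} {t} B∪s⊆U = mk⇔ to (λ eq → s⊆t eq , t⊆U eq)
  where
  F : Subset n
  F = U ─ (B ∪ s)

  B∪s∩F : ∀ {x} → x ∈ˢ B ∪ s → x ∉ˢ F
  B∪s∩F x∈B∪s x∈F = x∈p─q⇒x∉q U (B ∪ s) x∈F x∈B∪s

  into-s∪t∩B : t ⊆ U → t ─ F ⊆ s ∪ (t ∩ B)
  into-s∪t∩B t⊆U {x} x∈t─F with x ∈? (B ∪ s)
  ... | no x∉B∪s = ⊥-elim (x∈p─q⇒x∉q t F x∈t─F (x∈p∧x∉q⇒x∈p─q (t⊆U (p─q⊆p t F x∈t─F)) x∉B∪s))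
  ... | yes x∈B∪s with x∈p∪q⁻ B s x∈B∪s
  ...   | inj₁ x∈B = q⊆p∪q s (t ∩ B) (x∈p∩q⁺ (p─q⊆p t F x∈t─F , x∈B))
  ...   | inj₂ x∈s = p⊆p∪q (t ∩ B) x∈s

  from-s∪t∩B : s ⊆ t → s ∪ (t ∩ B) ⊆ t ─ F
  from-s∪t∩B s⊆t {x} x∈ with x∈p∪q⁻ s (t ∩ B) x∈
  ... | inj₁ x∈s   = x∈p∧x∉q⇒x∈p─q (s⊆t x∈s) (B∪s∩F (q⊆p∪q B s x∈s))
  ... | inj₂ x∈t∩B = x∈p∧x∉q⇒x∈p─q (p∩q⊆p t B x∈t∩B) (B∪s∩F (p⊆p∪q s (p∩q⊆q t B x∈t∩B)))

  to : s ⊆ t × t ⊆ U → t ─ F ≡ s ∪ (t ∩ B)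
  to (s⊆t , t⊆U) = ⊆-antisym (into-s∪t∩B t⊆U) (from-s∪t∩B s⊆t)

  s⊆t : t ─ F ≡ s ∪ (t ∩ B) → s ⊆ t
  s⊆t eq x∈s = p─q⊆p t F (subst (_ ∈ˢ_) (sym eq) (p⊆p∪q (t ∩ B) x∈s))

  t⊆U : t ─ F ≡ s ∪ (t ∩ B) → t ⊆ U
  t⊆U eq {x} x∈t with x ∈? F
  ... | yes x∈F = p─q⊆p U (B ∪ s) x∈F
  ... | no x∉F with x∈p∪q⁻ s (t ∩ B) (subst (_ ∈ˢ_) eq (x∈p∧x∉q⇒x∈p─q x∈t x∉F))
  ...   | inj₁ x∈s   = B∪s⊆U (q⊆p∪q B s x∈s)
  ...   | inj₂ x∈t∩B = B∪s⊆U (p⊆p∪q s (p∩q⊆q t B x∈t∩B))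

count : ∀ {n} {P : Subset n → Set} → Decidable P → ℕ
count {n} P? = length (filter P? (allSubsets n))

length-filter-map : ∀ {A B : Set} {P : B → Set} (P? : Decidable P) (f : A → B) (xs : List A) →
                    length (filter P? (map f xs)) ≡ length (filter (P? ∘ f) xs)
length-filter-map P? f [] = refl
length-filter-map P? f (x ∷ xs) with P? (f x)
... | yes _ = cong suc (length-filter-map P? f xs)
... | no _  = length-filter-map P? f xs

count-∷ : ∀ {n} {P : Subset (suc n) → Set} (P? : Decidable P) →
          count P? ≡ count (P? ∘ (false ∷_)) + count (P? ∘ (true ∷_))
count-∷ {n} P? = begin
  length (filter P? (map (false ∷_) S ++ map (true ∷_) S))
    ≡⟨ cong length (filter-++ P? (map (false ∷_) S) (map (true ∷_) S)) ⟩
  length (filter P? (map (false ∷_) S) ++ filter P? (map (true ∷_) S))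
    ≡⟨ length-++ (filter P? (map (false ∷_) S)) ⟩
  length (filter P? (map (false ∷_) S)) + length (filter P? (map (true ∷_) S))
    ≡⟨ cong₂ _+_ (length-filter-map P? (false ∷_) S) (length-filter-map P? (true ∷_) S) ⟩
  count (P? ∘ (false ∷_)) + count (P? ∘ (true ∷_)) ∎
  where
  S : List (Subset n)
  S = allSubsets n

count-cong : ∀ {n} {P Q : Subset n → Set} (P? : Decidable P) (Q? : Decidable Q) →
             (∀ t → P t ⇔ Q t) → count P? ≡ count Q?
count-cong {n} P? Q? P⇔Q = cong length
  (filter-≐ P? Q? ((λ {t} → Equivalence.to (P⇔Q t)) , (λ {t} → Equivalence.from (P⇔Q t))) (allSubsets n))

count-∅ : ∀ {n} {P : Subset n → Set} (P? : Decidable P) → (∀ t → ¬ P t) → count P? ≡ 0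
count-∅ {n} P? ¬P = cong length (filter-none P? (All.universal ¬P (allSubsets n)))

module _ {n : ℕ} {Q : Subset n → Set} where

  within? : (B : Subset n) → Decidable Q → Decidable (λ u → u ⊆ B × Q u)
  within? B Q? u = (u ⊆? B) ×-dec Q? u

  -- For pairwise disjoint F, B and s the t accepted here are exactly s ∪ f ∪ u with f ⊆ F and u ⊆ B.
  split? : (F B s : Subset n) → Decidable Q → Decidable (λ t → (t ─ F ≡ s ∪ (t ∩ B)) × Q (t ∩ B))
  split? F B s Q? t = ((t ─ F) ≟ˢ (s ∪ (t ∩ B))) ×-dec Q? (t ∩ B)

module _ {n : ℕ} {Q : Subset (suc n) → Set} (Q? : Decidable Q) where

  private
    Q₀ : Decidable (Q ∘ (false ∷_))
    Q₀ = Q? ∘ (false ∷_)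
    Q₁ : Decidable (Q ∘ (true ∷_))
    Q₁ = Q? ∘ (true ∷_)

  count-within-outside : (B : Subset n) → count (within? (false ∷ B) Q?) ≡ count (within? B Q₀)
  count-within-outside B = trans (count-∷ (within? (false ∷ B) Q?)) (trans
    (cong₂ _+_ (count-cong (within? (false ∷ B) Q? ∘ (false ∷_)) (within? B Q₀)
                  λ u → mk⇔ (λ (u⊆B , q) → drop-∷-⊆ u⊆B , q) (λ (u⊆B , q) → out⊆ u⊆B , q))
               (count-∅ (within? (false ∷ B) Q? ∘ (true ∷_)) λ u (u⊆B , _) → inside⊈outside u⊆B))
    (+-identityʳ _))

  count-within-inside : (B : Subset n) →
                        count (within? (true ∷ B) Q?) ≡ count (within? B Q₀) + count (within? B Q₁)
  count-within-inside B = trans (count-∷ (within? (true ∷ B) Q?))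
    (cong₂ _+_ (count-cong (within? (true ∷ B) Q? ∘ (false ∷_)) (within? B Q₀)
                  λ u → mk⇔ (λ (u⊆B , q) → drop-∷-⊆ u⊆B , q) (λ (u⊆B , q) → out⊆ u⊆B , q))
               (count-cong (within? (true ∷ B) Q? ∘ (true ∷_)) (within? B Q₁)
                  λ u → mk⇔ (λ (u⊆B , q) → drop-∷-⊆ u⊆B , q) (λ (u⊆B , q) → s⊆s u⊆B , q)))

  count-split-tail : ∀ x c (F B s : Subset n) →
    count (λ t → ((x ∷ (t ─ F)) ≟ˢ (x ∷ (s ∪ (t ∩ B)))) ×-dec Q? (c ∷ (t ∩ B))) ≡ count (split? F B s (Q? ∘ (c ∷_)))
  count-split-tail x c F B s = count-cong _ (split? F B s (Q? ∘ (c ∷_)))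
    λ t → mk⇔ (λ (eq , q) → ∷-injectiveʳ eq , q) (λ (eq , q) → cong (x ∷_) eq , q)

  count-split-free : (F B s : Subset n) →
    count (split? (true ∷ F) (false ∷ B) (false ∷ s) Q?) ≡ count (split? F B s Q₀) + count (split? F B s Q₀)
  count-split-free F B s = trans (count-∷ (split? (true ∷ F) (false ∷ B) (false ∷ s) Q?))
    (cong₂ _+_ (count-split-tail false false F B s) (count-split-tail false false F B s))

  count-split-inside : (F B s : Subset n) →
    count (split? (false ∷ F) (true ∷ B) (false ∷ s) Q?) ≡ count (split? F B s Q₀) + count (split? F B s Q₁)
  count-split-inside F B s = trans (count-∷ (split? (false ∷ F) (true ∷ B) (false ∷ s) Q?))
    (cong₂ _+_ (count-split-tail false false F B s) (count-split-tail true true F B s))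

  count-split-forced : (F B s : Subset n) →
    count (split? (false ∷ F) (false ∷ B) (true ∷ s) Q?) ≡ count (split? F B s Q₀)
  count-split-forced F B s = trans (count-∷ (split? (false ∷ F) (false ∷ B) (true ∷ s) Q?))
    (cong₂ _+_ (count-∅ (split? (false ∷ F) (false ∷ B) (true ∷ s) Q? ∘ (false ∷_)) λ { t (() , _) })
               (count-split-tail true false F B s))

  count-split-outside : (F B s : Subset n) →
    count (split? (false ∷ F) (false ∷ B) (false ∷ s) Q?) ≡ count (split? F B s Q₀)
  count-split-outside F B s = trans (count-∷ (split? (false ∷ F) (false ∷ B) (false ∷ s) Q?))
    (trans (cong₂ _+_ (count-split-tail false false F B s)
                      (count-∅ (split? (false ∷ F) (false ∷ B) (false ∷ s) Q? ∘ (true ∷_)) λ { t (() , _) }))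
           (+-identityʳ _))

  count-split-∷ : ∀ f β σ (F B s : Subset n) → f ∧ β ≡ false → f ∧ σ ≡ false → β ∧ σ ≡ false →
    (∀ {Q′ : Subset n → Set} (Q′? : Decidable Q′) → count (split? F B s Q′?) ≡ 2 ^ ∣ F ∣ * count (within? B Q′?)) →
    count (split? (f ∷ F) (β ∷ B) (σ ∷ s) Q?) ≡ 2 ^ ∣ f ∷ F ∣ * count (within? (β ∷ B) Q?)
  count-split-∷ true  true  _     F B s () _  _  _
  count-split-∷ true  _     true  F B s _  () _  _
  count-split-∷ _     true  true  F B s _  _  () _
  count-split-∷ true  false false F B s _  _  _  ih = begin
    count (split? (true ∷ F) (false ∷ B) (false ∷ s) Q?)           ≡⟨ count-split-free F B s ⟩
    count (split? F B s Q₀) + count (split? F B s Q₀)             ≡⟨ cong (λ k → k + k) (ih Q₀) ⟩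
    2 ^ ∣ F ∣ * count (within? B Q₀) + 2 ^ ∣ F ∣ * count (within? B Q₀)
                                                                   ≡⟨ cong (2 ^ ∣ F ∣ * count (within? B Q₀) +_) (+-identityʳ _) ⟨
    2 * (2 ^ ∣ F ∣ * count (within? B Q₀))                         ≡⟨ *-assoc 2 (2 ^ ∣ F ∣) _ ⟨
    2 ^ suc ∣ F ∣ * count (within? B Q₀)                           ≡⟨ cong (2 ^ suc ∣ F ∣ *_) (count-within-outside B) ⟨
    2 ^ suc ∣ F ∣ * count (within? (false ∷ B) Q?)                 ∎
  count-split-∷ false true  false F B s _  _  _  ih = begin
    count (split? (false ∷ F) (true ∷ B) (false ∷ s) Q?)           ≡⟨ count-split-inside F B s ⟩
    count (split? F B s Q₀) + count (split? F B s Q₁)             ≡⟨ cong₂ _+_ (ih Q₀) (ih Q₁) ⟩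
    2 ^ ∣ F ∣ * count (within? B Q₀) + 2 ^ ∣ F ∣ * count (within? B Q₁)
                                                                   ≡⟨ *-distribˡ-+ (2 ^ ∣ F ∣) _ _ ⟨
    2 ^ ∣ F ∣ * (count (within? B Q₀) + count (within? B Q₁))     ≡⟨ cong (2 ^ ∣ F ∣ *_) (count-within-inside B) ⟨
    2 ^ ∣ F ∣ * count (within? (true ∷ B) Q?)                      ∎
  count-split-∷ false false true  F B s _  _  _  ih = begin
    count (split? (false ∷ F) (false ∷ B) (true ∷ s) Q?)           ≡⟨ count-split-forced F B s ⟩
    count (split? F B s Q₀)                                        ≡⟨ ih Q₀ ⟩
    2 ^ ∣ F ∣ * count (within? B Q₀)                               ≡⟨ cong (2 ^ ∣ F ∣ *_) (count-within-outside B) ⟨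
    2 ^ ∣ F ∣ * count (within? (false ∷ B) Q?)                     ∎
  count-split-∷ false false false F B s _  _  _  ih = begin
    count (split? (false ∷ F) (false ∷ B) (false ∷ s) Q?)          ≡⟨ count-split-outside F B s ⟩
    count (split? F B s Q₀)                                        ≡⟨ ih Q₀ ⟩
    2 ^ ∣ F ∣ * count (within? B Q₀)                               ≡⟨ cong (2 ^ ∣ F ∣ *_) (count-within-outside B) ⟨
    2 ^ ∣ F ∣ * count (within? (false ∷ B) Q?)                     ∎

count-split : ∀ {n} {Q : Subset n → Set} (Q? : Decidable Q) (F B s : Subset n) →
              F ∩ B ≡ ⊥ → F ∩ s ≡ ⊥ → B ∩ s ≡ ⊥ →
              count (split? F B s Q?) ≡ 2 ^ ∣ F ∣ * count (within? B Q?)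
count-split Q? [] [] [] _ _ _ = trans
  (count-cong (split? [] [] [] Q?) (within? [] Q?) λ { [] → mk⇔ (λ (_ , q) → ⊆-refl , q) (λ (_ , q) → refl , q) })
  (sym (+-identityʳ _))
count-split Q? (f ∷ F) (β ∷ B) (σ ∷ s) F∩B F∩s B∩s =
  count-split-∷ Q? f β σ F B s (∷-injectiveˡ F∩B) (∷-injectiveˡ F∩s) (∷-injectiveˡ B∩s)
    λ Q′? → count-split Q′? F B s (∷-injectiveʳ F∩B) (∷-injectiveʳ F∩s) (∷-injectiveʳ B∩s)

module _ {n : ℕ} (G : Hypergraph n) (s : Subset n) where

  ∈-∖N⁻ : ∀ {g} → g ∈ G ∖N s → g ∈ G × ¬ Meets s g
  ∈-∖N⁻ = ∈-filter⁻ (¬? ∘ meets? s)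

  V-∖N⊆V : V (G ∖N s) ⊆ V G
  V-∖N⊆V x∈ with x∈⋃⁻ (G ∖N s) x∈
  ... | g , g∈ , x∈g = x∈⋃⁺ (proj₁ (∈-∖N⁻ g∈)) x∈g

  V-∖N∩≡⊥ : V (G ∖N s) ∩ s ≡ ⊥
  V-∖N∩≡⊥ = Empty-unique λ (x , x∈) → case x∈⋃⁻ (G ∖N s) (p∩q⊆p _ s x∈) of λ where
    (g , g∈ , x∈g) → proj₂ (∈-∖N⁻ g∈) (x , x∈p∩q⁺ (x∈g , p∩q⊆q _ s x∈))

s⊆V-−ᴴ : ∀ {n} {H : Hypergraph n} {e s : Subset n} → e ∈ H → s ⊆ e → s ⊆ V (H −ᴴ (e ─ s))
s⊆V-−ᴴ {e = e} {s} e∈H s⊆e x∈s =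
  x∈⋃⁺ (∈-map⁺ (_─ (e ─ s)) e∈H) (x∈p∧x∉q⇒x∈p─q (s⊆e x∈s) (λ x∈e─s → x∈p─q⇒x∉q e s x∈e─s x∈s))

module _ {n : ℕ} (H : Hypergraph n) (e s : Subset n) where

  private
    E : Subset n
    E = e ─ s
    H₁ H₂ : Hypergraph n
    H₁ = H −ᴴ E
    H₂ = H₁ ∖N s

    V₁⊆ : V H₁ ⊆ V H ─ E
    V₁⊆ = ⊆-reflexive (⋃-map-─ H E)

    ⊆V₁ : V H ─ E ⊆ V H₁
    ⊆V₁ = ⊆-reflexive (sym (⋃-map-─ H E))

  module _ {t : Subset n} (s⊆t : s ⊆ t) (t⊆V₁ : t ⊆ V H₁) where

    meets-restriction : All (Meets t) H → ∀ {g} → g ∈ H₂ → Meets (t ∩ V H₂) g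
    meets-restriction hits g∈H₂ with ∈-map⁻ (_─ E) (proj₁ (∈-∖N⁻ H₁ s g∈H₂))
    ... | f , f∈H , refl with All.lookup hits f∈H
    ... | x , x∈f∩t = x , x∈p∩q⁺ (x∈g , x∈p∩q⁺ (x∈t , x∈⋃⁺ g∈H₂ x∈g))
      where
      x∈t : x ∈ˢ t
      x∈t = p∩q⊆q f t x∈f∩t
      x∈g : x ∈ˢ f ─ E
      x∈g = x∈p∧x∉q⇒x∈p─q (p∩q⊆p f t x∈f∩t) (x∈p─q⇒x∉q (V H) E (V₁⊆ (t⊆V₁ x∈t)))

    meets-original : All (Meets (t ∩ V H₂)) H₂ → ∀ {f} → f ∈ H → Meets t f
    meets-original hits₂ {f} f∈H with meets? s (f ─ E)
    ... | yes (x , x∈) = x , x∈p∩q⁺ (p─q⊆p f E (p∩q⊆p _ s x∈) , s⊆t (p∩q⊆q _ s x∈))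
    ... | no ¬meets with All.lookup hits₂ (∈-filter⁺ (¬? ∘ meets? s) (∈-map⁺ (_─ E) f∈H) ¬meets)
    ...   | x , x∈ = x , x∈p∩q⁺ (p─q⊆p f E (p∩q⊆p _ _ x∈) , p∩q⊆p t (V H₂) (p∩q⊆q _ _ x∈))

    hits⇔hits-restriction : All (Meets t) H ⇔ All (Meets (t ∩ V H₂)) H₂
    hits⇔hits-restriction = mk⇔ (λ hits → All.tabulate (meets-restriction hits))
                                (λ hits₂ → All.tabulate (meets-original hits₂))

  isHit×∩≡⇔ : s ⊆ e → ∀ t →
              (IsHit H t × t ∩ e ≡ s) ⇔ ((s ⊆ t × t ⊆ V H₁) × All (Meets (t ∩ V H₂)) H₂)
  isHit×∩≡⇔ s⊆e t = mk⇔ to from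
    where
    to : IsHit H t × t ∩ e ≡ s → (s ⊆ t × t ⊆ V H₁) × All (Meets (t ∩ V H₂)) H₂
    to ((t⊆V , hits) , t∩e≡s) = (s⊆t , t⊆V₁) , Equivalence.to (hits⇔hits-restriction s⊆t t⊆V₁) hits
      where
      s⊆t : s ⊆ t
      s⊆t x∈s = p∩q⊆p t e (subst (_ ∈ˢ_) (sym t∩e≡s) x∈s)
      t⊆V₁ : t ⊆ V H₁
      t⊆V₁ x∈t = ⊆V₁ (x∈p∧x∉q⇒x∈p─q (t⊆V x∈t) λ x∈E →
        x∈p─q⇒x∉q e s x∈E (subst (_ ∈ˢ_) t∩e≡s (x∈p∩q⁺ (x∈t , p─q⊆p e s x∈E))))

    from : (s ⊆ t × t ⊆ V H₁) × All (Meets (t ∩ V H₂)) H₂ → IsHit H t × t ∩ e ≡ s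
    from ((s⊆t , t⊆V₁) , hits₂) =
      (t⊆V , Equivalence.from (hits⇔hits-restriction s⊆t t⊆V₁) hits₂) ,
      ⊆-antisym t∩e⊆s (λ x∈s → x∈p∩q⁺ (s⊆t x∈s , s⊆e x∈s))
      where
      t⊆V : t ⊆ V H
      t⊆V x∈t = p─q⊆p (V H) E (V₁⊆ (t⊆V₁ x∈t))
      t∩e⊆s : t ∩ e ⊆ s
      t∩e⊆s {x} x∈t∩e with x ∈? s
      ... | yes x∈s = x∈s
      ... | no  x∉s = ⊥-elim (x∈p─q⇒x∉q (V H) E (V₁⊆ (t⊆V₁ (p∩q⊆p t e x∈t∩e)))
                                        (x∈p∧x∉q⇒x∈p─q (p∩q⊆q t e x∈t∩e) x∉s))

lemma6 : ∀ {n} (H : Hypergraph n) → H ≢ [] →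
         (e : Subset n) → e ∈ H →
         (s : Subset n) → s ⊆ e → Nonempty s →
         let H₁ = H −ᴴ (e ─ s)
             H₂ = H₁ ∖N s
             n₁ = ∣ V H₁ ─ (V H₂ ∪ s) ∣
         in numHitES H e s ≡ 2 ^ n₁ * numHit H₂
lemma6 {n} H _ e e∈H s s⊆e _ = begin
  numHitES H e s
    ≡⟨ count-cong _ (split? F B s Q?) (λ t → (s⊆t⊆U⇔split B∪s⊆V₁ ×-⇔ ⇔-id _) ⇔-∘ isHit×∩≡⇔ H e s s⊆e t) ⟩
  count (split? F B s Q?)
    ≡⟨ count-split Q? F B s (p─q∩r≡⊥ (V H₁) (p⊆p∪q s)) (p─q∩r≡⊥ (V H₁) (q⊆p∪q B s)) (V-∖N∩≡⊥ H₁ s) ⟩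
  2 ^ ∣ F ∣ * numHit H₂ ∎
  where
  H₁ H₂ : Hypergraph n
  H₁ = H −ᴴ (e ─ s)
  H₂ = H₁ ∖N s
  B F : Subset n
  B = V H₂
  F = V H₁ ─ (B ∪ s)
  Q? : Decidable (λ u → All (Meets u) H₂)
  Q? u = All.all? (meets? u) H₂

  B∪s⊆V₁ : B ∪ s ⊆ V H₁
  B∪s⊆V₁ x∈ = [ V-∖N⊆V H₁ s , s⊆V-−ᴴ e∈H s⊆e ] (x∈p∪q⁻ B s x∈)
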